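{- If $T$ is either an arborescence or an anti-arborescence, then its idomatic number is $id(T)=1$.
   Context: An arborescence (out-tree) is an orientation of a finite tree having a root $r$ such that all arcs are directed away from $r$; an anti-arborescence (in-tree) is the reversal of an arborescence. In a digraph $D$, a set $S\subseteq V(D)$ is an independent dominating set if no arc of $D$ joins two vertices of $S$ and every vertex $u\in V(D)\setminus S$ has some $v\in S$ with $vu\in A(D)$. The idomatic number $id(D)$ is the maximum number of pairwise disjoint independent dominating sets of $D$. -}

module Defs where

open import Data.Nat using (ℕ; zero; suc; _≤_)
open import Data.Fin using (Fin; zero; suc; inject₁; fromℕ)
open import Data.Fin.Subset using (Subset; _∈_; _∉_)
open import Data.Product using (Σ; ∃; _×_; _,_)
open import Data.Sum using (_⊎_)
open import Function using (flip)
open import Function.Definitions using (Injective)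
open import Relation.Nullary using (¬_)
open import Relation.Binary.PropositionalEquality using (_≡_; _≢_)
open import Relation.Binary.Construct.Closure.ReflexiveTransitive using (Star)

-- A digraph on the vertex set Fin n, given by its arc relation:
-- D u v  means that  uv  is an arc.
Digraph : ℕ → Set₁
Digraph n = Fin n → Fin n → Set

module _ {n : ℕ} (D : Digraph n) where

  Underlying : Fin n → Fin n → Set
  Underlying u v = D u v ⊎ D v u

  -- D is an orientation of a simple graph: no loops, no pair of opposite arcs
  -- (asymmetry also excludes loops)
  Oriented : Set
  Oriented = ∀ u v → D u v → ¬ D v u

  Connected : Set
  Connected = ∀ u v → Star Underlying u v

  -- a cycle of length k+3 in the underlying graph:
  -- distinct vertices c 0, …, c (k+2), consecutive ones adjacent, and c (k+2) adjacent to c 0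
  HasCycle : Set
  HasCycle = Σ ℕ λ k → Σ (Fin (suc (suc (suc k))) → Fin n) λ c →
               Injective _≡_ _≡_ c
             × (∀ (i : Fin (suc (suc k))) → Underlying (c (inject₁ i)) (c (suc i)))
             × Underlying (c (fromℕ (suc (suc k)))) (c zero)

  IsTree : Set
  IsTree = Connected × ¬ HasCycle

  -- arborescence: an orientation of a tree having a root r with all arcs
  -- directed away from r, i.e. every vertex is reached from r by a directed path
  IsArborescence : Set
  IsArborescence = Oriented × IsTree × Σ (Fin n) λ r → ∀ v → Star D r v

  Independent : Subset n → Set
  Independent S = ∀ u v → u ∈ S → v ∈ S → ¬ D u v

  Dominating : Subset n → Set
  Dominating S = ∀ u → u ∉ S → ∃ λ v → v ∈ S × D v u

  IsIDS : Subset n → Set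
  IsIDS S = Independent S × Dominating S

  HasDisjointIDSs : ℕ → Set
  HasDisjointIDSs k = Σ (Fin k → Subset n) λ F →
                        (∀ i → IsIDS (F i))
                      × (∀ i j → i ≢ j → ∀ v → v ∈ F i → v ∉ F j)

  IdomaticNumber : ℕ → Set
  IdomaticNumber k = HasDisjointIDSs k × (∀ m → HasDisjointIDSs m → m ≤ k)

IsAntiArborescence : ∀ {n} → Digraph n → Set
IsAntiArborescence D = IsArborescence (flip D)

-- Lower bound.  A digraph with decidable arcs and a rank function that
-- strictly increases along arcs has an independent dominating set: select a
-- vertex exactly when none of its in-neighbours is selected.  This is
-- well founded by recursion on the rank (realised below as an iteration that
-- stabilises after more rounds than the rank).  In an arborescence the depth
-- of a vertex is such a rank, and  n ∸ depth  is one for the reversed digraph.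
--
-- Upper bound.  Two disjoint independent dominating sets would give every
-- vertex an in-neighbour; the root of an arborescence, and a leaf of the
-- arborescence underlying an anti-arborescence, have none.
--
-- Both bounds rest on the basic tree facts: the root has no parent, every
-- vertex has at most one parent, depths are well defined and below n, and arcs
-- are decidable.  They all follow from one lemma: a walk in the
-- underlying graph that never immediately backtracks visits distinct vertices,
-- since otherwise it contains a cycle.

module Submission where

open import Defs
open import Data.Nat using (ℕ; zero; suc; _≤_; _<_; _∸_; z≤n; s≤s)
open import Data.Nat.Properties
  using (≤-reflexive; <-≤-trans; <⇒≤; <-irrefl; n≤1+n; m∸n≤m; ∸-monoʳ-<)
open import Data.Bool using (Bool; true; not)
import Data.Bool as Bool
open import Data.Bool.Properties using (not-¬)
open import Data.Fin using (Fin; zero; suc; inject₁; fromℕ; _≟_)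
open import Data.Fin.Properties using (any?; injective⇒≤)
open import Data.Fin.Subset using (Subset; _∈_; _∉_)
open import Data.Fin.Subset.Properties using (_∈?_)
open import Data.Vec using (tabulate)
open import Data.Vec.Properties using (lookup∘tabulate; []=⇒lookup; lookup⇒[]=)
open import Data.List using (List; []; _∷_; _++_; length; lookup; reverseAcc)
open import Data.List.Relation.Unary.Any as Any using (here; there)
open import Data.List.Relation.Unary.All as All using ([]; _∷_)
open import Data.List.Relation.Unary.All.Properties using (¬Any⇒All¬; ++⁻)
import Data.List.Relation.Unary.AllPairs as AllPairs
open import Data.List.Relation.Unary.Linked as Linked using (Linked; []; [-]; _∷_)
open import Data.List.Relation.Unary.Unique.Propositional using (Unique; []; _∷_)
open import Data.List.Relation.Unary.Unique.Propositional.Properties using (Unique[x∷xs]⇒x∉xs)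
open import Data.List.Membership.Propositional using () renaming (_∈_ to _∈ₗ_)
open import Data.List.Membership.Propositional.Properties using (∈-lookup; ∈-∃++)
open import Data.Product using (∃; _×_; _,_; proj₁; proj₂)
open import Data.Sum using (_⊎_; inj₁; inj₂)
open import Data.Unit using (⊤; tt)
open import Data.Empty using (⊥; ⊥-elim)
open import Function using (flip; id; _∘_)
open import Function.Bundles using (mk⇔)
open import Relation.Nullary using (¬_; Dec; yes; no; does)
open import Relation.Nullary.Decidable using (_×-dec_; dec-true; dec-false; decidable-stable; does-⇔)
open import Relation.Binary.Definitions using (Symmetric)
open import Relation.Binary.PropositionalEquality using (_≡_; _≢_; refl; sym; trans; cong; subst)
open import Relation.Binary.Construct.Closure.ReflexiveTransitive as Star using (Star; ε; _◅_)

module _ {A : Set} where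

  NonBacktracking : List A → Set
  NonBacktracking (x ∷ y ∷ z ∷ zs) = x ≢ z × NonBacktracking (y ∷ z ∷ zs)
  NonBacktracking _ = ⊤

  nonBacktracking-tail : ∀ {x} xs → NonBacktracking (x ∷ xs) → NonBacktracking xs
  nonBacktracking-tail [] _ = tt
  nonBacktracking-tail (_ ∷ []) _ = tt
  nonBacktracking-tail (_ ∷ _ ∷ _) (_ , nb) = nb

  HeadsDiffer : List A → List A → Set
  HeadsDiffer (x ∷ _) (y ∷ _) = x ≢ y
  HeadsDiffer _ _ = ⊤

  -- Gluing the reversal of  x ∷ xs  onto  x ∷ acc  at  x  creates no
  -- backtracking, provided the two neighbours of  x  differ.
  nonBacktracking-reverseAcc : ∀ {x} xs acc → NonBacktracking (x ∷ xs) → NonBacktracking (x ∷ acc) →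
                               HeadsDiffer xs acc → NonBacktracking (reverseAcc (x ∷ acc) xs)
  nonBacktracking-reverseAcc [] acc _ nb-acc _ = nb-acc
  nonBacktracking-reverseAcc {x} (y ∷ xs) acc nb-xs nb-acc y≢ =
    nonBacktracking-reverseAcc xs (x ∷ acc) (nonBacktracking-tail (y ∷ xs) nb-xs) (turn acc y≢ nb-acc) (leave xs nb-xs)
    where
    turn : ∀ acc → HeadsDiffer (y ∷ xs) acc → NonBacktracking (x ∷ acc) → NonBacktracking (y ∷ x ∷ acc)
    turn [] _ _ = tt
    turn (_ ∷ _) y≢z nb = y≢z , nb
    leave : ∀ xs → NonBacktracking (x ∷ y ∷ xs) → HeadsDiffer xs (x ∷ acc)
    leave [] _ = tt
    leave (_ ∷ _) (x≢z , _) = x≢z ∘ sym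

  module _ {R : A → A → Set} where

    linked-reverseAcc : Symmetric R → ∀ {x} xs acc → Linked R (x ∷ xs) → Linked R (x ∷ acc) →
                        Linked R (reverseAcc (x ∷ acc) xs)
    linked-reverseAcc R-sym [] acc _ l-acc = l-acc
    linked-reverseAcc R-sym {x} (y ∷ xs) acc l-xs l-acc =
      linked-reverseAcc R-sym xs (x ∷ acc) (Linked.tail l-xs) (R-sym (Linked.head l-xs) ∷ l-acc)

    linked-prefix : ∀ xs {ys} → Linked R (xs ++ ys) → Linked R xs
    linked-prefix [] _ = []
    linked-prefix (_ ∷ []) _ = [-]
    linked-prefix (_ ∷ y ∷ xs) (rel ∷ l) = rel ∷ linked-prefix (y ∷ xs) l

    linked-lookup : ∀ {x} xs → Linked R (x ∷ xs) → (i : Fin (length xs)) →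
                    R (lookup (x ∷ xs) (inject₁ i)) (lookup xs i)
    linked-lookup (_ ∷ _) (rel ∷ _) zero = rel
    linked-lookup (_ ∷ xs) (_ ∷ l) (suc i) = linked-lookup xs l i

    linked-last : ∀ {x y} zs {ws} → Linked R (y ∷ zs ++ x ∷ ws) → R (lookup (y ∷ zs) (fromℕ (length zs))) x
    linked-last [] (rel ∷ _) = rel
    linked-last (_ ∷ zs) (_ ∷ l) = linked-last zs l

  unique-lookup-injective : ∀ {xs : List A} → Unique xs → ∀ i j → lookup xs i ≡ lookup xs j → i ≡ j
  unique-lookup-injective (_ ∷ _) zero zero _ = refl
  unique-lookup-injective (x∉ ∷ _) zero (suc j) eq = ⊥-elim (All.lookup x∉ (∈-lookup j) eq)
  unique-lookup-injective (x∉ ∷ _) (suc i) zero eq = ⊥-elim (All.lookup x∉ (∈-lookup i) (sym eq))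
  unique-lookup-injective (_ ∷ u) (suc i) (suc j) eq = cong suc (unique-lookup-injective u i j eq)

  unique-prefix : ∀ {x : A} (zs : List A) {ws} → Unique (zs ++ x ∷ ws) → Unique (x ∷ zs)
  unique-prefix [] _ = [] ∷ []
  unique-prefix (z ∷ zs) (z∉ ∷ u) with ++⁻ zs z∉ | unique-prefix zs u
  ... | z∉zs , z≢x ∷ _ | x∉zs ∷ u-zs = ((z≢x ∘ sym) ∷ x∉zs) ∷ z∉zs ∷ u-zs

  unique-reverseAcc-suffix : ∀ (acc xs : List A) → Unique (reverseAcc acc xs) → Unique acc
  unique-reverseAcc-suffix acc [] u = u
  unique-reverseAcc-suffix acc (x ∷ xs) u = AllPairs.tail (unique-reverseAcc-suffix (x ∷ acc) xs u)

  unique-reverseAcc : ∀ {y} (acc xs : List A) → Unique (reverseAcc acc xs) → y ∈ₗ xs → y ∈ₗ acc → ⊥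
  unique-reverseAcc acc (x ∷ xs) u (here refl) y∈acc =
    All.lookup (AllPairs.head (unique-reverseAcc-suffix (x ∷ acc) xs u)) y∈acc refl
  unique-reverseAcc acc (x ∷ xs) u (there y∈xs) y∈acc = unique-reverseAcc (x ∷ acc) xs u y∈xs (there y∈acc)

unique-length : ∀ {n} {xs : List (Fin n)} → Unique xs → length xs ≤ n
unique-length u = injective⇒≤ (λ {i} {j} → unique-lookup-injective u i j)

module Trails {n : ℕ} (D : Digraph n) (oriented : Oriented D) where

  underlying-sym : Symmetric (Underlying D)
  underlying-sym (inj₁ uv) = inj₂ uv
  underlying-sym (inj₂ vu) = inj₁ vu

  underlying-irrefl : ∀ {x} → ¬ Underlying D x x
  underlying-irrefl (inj₁ xx) = oriented _ _ xx xx
  underlying-irrefl (inj₂ xx) = oriented _ _ xx xx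

  -- A non-backtracking closed walk  x ∷ zs ++ x  whose first part  x ∷ zs
  -- has distinct vertices is a cycle; it has at least three vertices since
  -- there are no loops and no backtracking.
  closedTrail⇒cycle : ∀ x zs ws → Unique (x ∷ zs) → Linked (Underlying D) (x ∷ zs ++ x ∷ ws) →
                      NonBacktracking (x ∷ zs ++ x ∷ ws) → HasCycle D
  closedTrail⇒cycle x [] ws _ (xx ∷ _) _ = ⊥-elim (underlying-irrefl xx)
  closedTrail⇒cycle x (_ ∷ []) ws _ _ (x≢x , _) = ⊥-elim (x≢x refl)
  closedTrail⇒cycle x zs@(_ ∷ _ ∷ zs′) ws u l _ =
      length zs′
    , lookup (x ∷ zs)
    , (λ {i} {j} → unique-lookup-injective u i j)
    , linked-lookup zs (linked-prefix (x ∷ zs) l)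
    , linked-last zs l

  -- In an acyclic oriented digraph, a non-backtracking walk of the
  -- underlying graph never revisits a vertex: cut at the first repetition.
  trail-unique : ¬ HasCycle D → ∀ xs → Linked (Underlying D) xs → NonBacktracking xs → Unique xs
  trail-unique acyclic [] _ _ = []
  trail-unique acyclic (x ∷ xs) l nb
    with trail-unique acyclic xs (Linked.tail l) (nonBacktracking-tail xs nb) | Any.any? (x ≟_) xs
  ... | u | no x∉xs = ¬Any⇒All¬ xs x∉xs ∷ u
  ... | u | yes x∈xs with ∈-∃++ x∈xs
  ...   | zs , ws , refl = ⊥-elim (acyclic (closedTrail⇒cycle x zs ws (unique-prefix zs u) l nb))

module Arborescence {n : ℕ} (A : Digraph n) (oriented : Oriented A) (acyclic : ¬ HasCycle A)
                    (r : Fin n) (reach : ∀ v → Star A r v) where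

  open Trails A oriented

  RootPath : Fin n → Set
  RootPath v = Star (flip A) v r

  rootPath : ∀ v → RootPath v
  rootPath v = Star.reverse id (reach v)

  pathLength : ∀ {v} → RootPath v → ℕ
  pathLength ε = 0
  pathLength (_ ◅ p) = suc (pathLength p)

  trace : ∀ {v} → RootPath v → List (Fin n)
  ancestors : ∀ {v} → RootPath v → List (Fin n)
  trace {v} p = v ∷ ancestors p
  ancestors ε = []
  ancestors (_ ◅ p) = trace p

  trace-linked : ∀ {v} (p : RootPath v) → Linked (Underlying A) (trace p)
  trace-linked ε = [-]
  trace-linked (uv ◅ p) = inj₂ uv ∷ trace-linked p

  -- Two consecutive arcs of a directed path never form a 2-cycle.
  trace-nonBacktracking : ∀ {v} (p : RootPath v) → NonBacktracking (trace p)
  trace-nonBacktracking ε = tt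
  trace-nonBacktracking (_ ◅ ε) = tt
  trace-nonBacktracking (uv ◅ wu ◅ p) = (λ { refl → oriented _ _ uv wu }) , trace-nonBacktracking (wu ◅ p)

  trace-unique : ∀ {v} (p : RootPath v) → Unique (trace p)
  trace-unique p = trail-unique acyclic (trace p) (trace-linked p) (trace-nonBacktracking p)

  root∈trace : ∀ {v} (p : RootPath v) → r ∈ₗ trace p
  root∈trace ε = here refl
  root∈trace (_ ◅ p) = there (root∈trace p)

  length-trace : ∀ {v} (p : RootPath v) → length (trace p) ≡ suc (pathLength p)
  length-trace ε = refl
  length-trace (_ ◅ p) = cong suc (length-trace p)

  pathLength<n : ∀ {v} (p : RootPath v) → pathLength p < n
  pathLength<n p = subst (_≤ n) (length-trace p) (unique-length (trace-unique p))

  -- An arc  a → r  would make the root appear twice on the trail  r … a r.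
  root-has-no-parent : ∀ {a} → ¬ A a r
  root-has-no-parent {a} ar = Unique[x∷xs]⇒x∉xs (trace-unique (ar ◅ rootPath a)) (root∈trace (rootPath a))

  -- Two parents  a ≠ b  of  v  give the closed trail  r … b v a … r.
  parent-unique : ∀ {a b v} → A a v → A b v → a ≡ b
  parent-unique {a} {b} {v} av bv with a ≟ b
  ... | yes a≡b = a≡b
  ... | no a≢b =
    ⊥-elim (unique-reverseAcc (v ∷ trace pa) (trace pb) (trail-unique acyclic _ linked nonBacktracking)
                              (root∈trace pb) (there (root∈trace pa)))
    where
    pa = rootPath a
    pb = rootPath b
    linked : Linked (Underlying A) (reverseAcc (v ∷ trace pa) (trace pb))
    linked = linked-reverseAcc underlying-sym (ancestors pb) (v ∷ trace pa)
               (trace-linked pb) (inj₁ bv ∷ inj₂ av ∷ trace-linked pa)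
    grandparent≢v : ∀ {x} (p : RootPath x) → A x v → HeadsDiffer (ancestors p) (v ∷ trace pa)
    grandparent≢v ε _ = tt
    grandparent≢v (yx ◅ _) xv = λ { refl → oriented _ _ yx xv }
    nonBacktracking : NonBacktracking (reverseAcc (v ∷ trace pa) (trace pb))
    nonBacktracking = nonBacktracking-reverseAcc (ancestors pb) (v ∷ trace pa) (trace-nonBacktracking pb)
                        (a≢b ∘ sym , trace-nonBacktracking (av ◅ pa)) (grandparent≢v pb bv)

  pathLength-unique : ∀ {v} (p q : RootPath v) → pathLength p ≡ pathLength q
  pathLength-unique ε ε = refl
  pathLength-unique ε (ar ◅ _) = ⊥-elim (root-has-no-parent ar)
  pathLength-unique (ar ◅ _) ε = ⊥-elim (root-has-no-parent ar)
  pathLength-unique (av ◅ p) (bv ◅ q) with parent-unique av bv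
  ... | refl = cong suc (pathLength-unique p q)

  depth : Fin n → ℕ
  depth v = pathLength (rootPath v)

  depth-root : depth r ≡ 0
  depth-root = pathLength-unique (rootPath r) ε

  depth-step : ∀ {u v} → A u v → depth v ≡ suc (depth u)
  depth-step {u} uv = pathLength-unique (rootPath _) (uv ◅ rootPath u)

  depth<n : ∀ v → depth v < n
  depth<n v = pathLength<n (rootPath v)

  depth-increases : ∀ {u v} → A u v → depth u < depth v
  depth-increases uv = ≤-reflexive (sym (depth-step uv))

  codepth : Fin n → ℕ
  codepth v = n ∸ depth v

  codepth<1+n : ∀ v → codepth v < suc n
  codepth<1+n v = s≤s (m∸n≤m n (depth v))

  codepth-decreases : ∀ {u v} → A u v → codepth v < codepth u
  codepth-decreases {v = v} uv = ∸-monoʳ-< (depth-increases uv) (<⇒≤ (depth<n v))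

  root-or-child : ∀ {v} → RootPath v → v ≡ r ⊎ ∃ λ u → A u v
  root-or-child ε = inj₁ refl
  root-or-child (uv ◅ _) = inj₂ (_ , uv)

  -- Arcs are decidable: the only candidate parent of  v  is that last step.
  arc? : ∀ u v → Dec (A u v)
  arc? u v with root-or-child (rootPath v)
  ... | inj₁ refl = no root-has-no-parent
  ... | inj₂ (w , wv) with u ≟ w
  ...   | yes refl = yes wv
  ...   | no u≢w = no λ uv → u≢w (parent-unique uv wv)

  -- Following children forever would reach depth n.
  has-leaf : ¬ (∀ v → ∃ λ u → A v u)
  has-leaf child = <-irrefl refl (subst (_< n) (depth-descend n) (depth<n (descend n)))
    where
    descend : ℕ → Fin n
    descend zero = r
    descend (suc k) = proj₁ (child (descend k))
    depth-descend : ∀ k → depth (descend k) ≡ k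
    depth-descend zero = depth-root
    depth-descend (suc k) = trans (depth-step (proj₂ (child (descend k)))) (cong suc (depth-descend k))

module Kernel {n : ℕ} (D : Digraph n) (arc? : ∀ u v → Dec (D u v))
              (rank : Fin n → ℕ) (bound : ℕ) (rank<bound : ∀ v → rank v < bound)
              (rank-increases : ∀ {u v} → D u v → rank u < rank v) where

  ChosenInNeighbour : (Fin n → Bool) → Fin n → Set
  ChosenInNeighbour χ v = ∃ λ u → D u v × χ u ≡ true

  chosenInNeighbour? : ∀ χ v → Dec (ChosenInNeighbour χ v)
  chosenInNeighbour? χ v = any? λ u → arc? u v ×-dec (χ u Bool.≟ true)

  select : (Fin n → Bool) → Fin n → Bool
  select χ v = not (does (chosenInNeighbour? χ v))

  select-local : ∀ {χ χ′} v → (∀ u → D u v → χ u ≡ χ′ u) → select χ v ≡ select χ′ v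
  select-local {χ} {χ′} v agree = cong not (does-⇔ (mk⇔ to from) (chosenInNeighbour? χ v) (chosenInNeighbour? χ′ v))
    where
    to : ChosenInNeighbour χ v → ChosenInNeighbour χ′ v
    to (u , uv , χu) = u , uv , trans (sym (agree u uv)) χu
    from : ChosenInNeighbour χ′ v → ChosenInNeighbour χ v
    from (u , uv , χ′u) = u , uv , trans (agree u uv) χ′u

  iterate : ℕ → Fin n → Bool
  iterate zero _ = true
  iterate (suc k) = select (iterate k)

  iterate-stable : ∀ m k v → rank v < m → m ≤ k → iterate k v ≡ iterate m v
  iterate-stable (suc m) (suc k) v (s≤s rank≤m) (s≤s m≤k) =
    select-local v λ u uv → iterate-stable m k u (<-≤-trans (rank-increases uv) rank≤m) m≤k

  kernel : Fin n → Bool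
  kernel = iterate bound

  kernel-fixed : ∀ v → kernel v ≡ select kernel v
  kernel-fixed v = sym (iterate-stable bound (suc bound) v (rank<bound v) (n≤1+n bound))

  kernelSet : Subset n
  kernelSet = tabulate kernel

  ∈kernelSet⁺ : ∀ {v} → kernel v ≡ true → v ∈ kernelSet
  ∈kernelSet⁺ {v} kv = lookup⇒[]= v kernelSet (trans (lookup∘tabulate kernel v) kv)

  ∈kernelSet⁻ : ∀ {v} → v ∈ kernelSet → kernel v ≡ true
  ∈kernelSet⁻ {v} v∈ = trans (sym (lookup∘tabulate kernel v)) ([]=⇒lookup v∈)

  kernel-IDS : IsIDS D kernelSet
  kernel-IDS = independent , dominating
    where
    independent : Independent D kernelSet
    independent u v u∈ v∈ uv = not-¬ refl
      (trans (sym (∈kernelSet⁻ v∈))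
             (trans (kernel-fixed v) (cong not (dec-true (chosenInNeighbour? kernel v) (u , uv , ∈kernelSet⁻ u∈)))))
    dominating : Dominating D kernelSet
    dominating v v∉ = chosen (decidable-stable (chosenInNeighbour? kernel v) unchosen)
      where
      unchosen : ¬ ¬ ChosenInNeighbour kernel v
      unchosen none = v∉ (∈kernelSet⁺ (trans (kernel-fixed v) (cong not (dec-false (chosenInNeighbour? kernel v) none))))
      chosen : ChosenInNeighbour kernel v → ∃ λ u → u ∈ kernelSet × D u v
      chosen (u , uv , ku) = u , ∈kernelSet⁺ ku , uv

module _ {n : ℕ} (D : Digraph n) where

  -- Every vertex lies outside one of two disjoint sets, so two disjoint
  -- dominating sets give every vertex an in-neighbour.
  disjointIDSs⇒in-neighbours : ∀ {m} → HasDisjointIDSs D (suc (suc m)) → ∀ v → ∃ λ u → D u v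
  disjointIDSs⇒in-neighbours (F , ids , disjoint) v with v ∈? F zero
  ... | yes v∈F₀ = let u , _ , uv = proj₂ (ids (suc zero)) v (disjoint zero (suc zero) (λ ()) v v∈F₀) in u , uv
  ... | no v∉F₀ = let u , _ , uv = proj₂ (ids zero) v v∉F₀ in u , uv

  idomaticNumber-one : ∀ {S} → IsIDS D S → ¬ (∀ v → ∃ λ u → D u v) → IdomaticNumber D 1
  idomaticNumber-one {S} ids no-source = ((λ _ → S) , (λ _ → ids) , disjoint) , at-most-one
    where
    disjoint : ∀ (i j : Fin 1) → i ≢ j → ∀ v → v ∈ S → v ∉ S
    disjoint zero zero 0≢0 = ⊥-elim (0≢0 refl)
    at-most-one : ∀ m → HasDisjointIDSs D m → m ≤ 1
    at-most-one zero _ = z≤n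
    at-most-one (suc zero) _ = s≤s z≤n
    at-most-one (suc (suc m)) two = ⊥-elim (no-source (disjointIDSs⇒in-neighbours two))

mainTheorem19 : (n : ℕ) (T : Digraph n) → IsArborescence T ⊎ IsAntiArborescence T → IdomaticNumber T 1
mainTheorem19 n T (inj₁ (oriented , (_ , acyclic) , r , reach)) =
  idomaticNumber-one T (Kernel.kernel-IDS T arc? depth n depth<n depth-increases)
                       (λ parent → root-has-no-parent (proj₂ (parent r)))
  where open Arborescence T oriented acyclic r reach
mainTheorem19 n T (inj₂ (oriented , (_ , acyclic) , r , reach)) =
  idomaticNumber-one T (Kernel.kernel-IDS T (flip arc?) codepth (suc n) codepth<1+n codepth-decreases)
                       has-leaf
  where open Arborescence (flip T) oriented acyclic r reach
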